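{- Let $\Omega$ be a set and $\mathcal{C}$ a finite set of subsets of $\Omega$. Then the patchwork on $\Omega$ generated by $\mathcal{C}$ is finite.
   Context: Subsets $A,B\subseteq\Omega$ overlap if $A\cap B\neq\emptyset$ but neither contains the other. A patchwork on $\Omega$ is a set $\mathcal{P}$ of subsets of $\Omega$ such that $\emptyset,\Omega\in\mathcal{P}$ and for every pair of overlapping $A,B\in\mathcal{P}$, the sets $A\cap B$, $A\cup B$, $A\setminus B$ belong to $\mathcal{P}$. The patchwork generated by $\mathcal{C}$ is the smallest patchwork on $\Omega$ containing $\mathcal{C}$ (the intersection of all patchworks on $\Omega$ containing $\mathcal{C}$). -}

module Defs where

open import Level using (Level; suc; Lift)
open import Data.Empty using (⊥)
open import Data.Unit using (⊤)
open import Data.Product using (_×_; ∃; Σ-syntax)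
open import Data.List using (List)
open import Data.List.Membership.Propositional using (_∈_)
open import Relation.Nullary using (¬_)
open import Relation.Unary using (Pred; _⊆_; _≐_; _∩_; _∪_; _∖_)

private variable ℓ : Level

-- Subsets of Ω are predicates on Ω; a "set of subsets" is a predicate on
-- subsets that respects extensional equality _≐_ of subsets.

emptySet : (Ω : Set ℓ) → Pred Ω ℓ
emptySet Ω = λ _ → Lift _ ⊥

fullSet : (Ω : Set ℓ) → Pred Ω ℓ
fullSet Ω = λ _ → Lift _ ⊤

Overlap : {Ω : Set ℓ} → Pred Ω ℓ → Pred Ω ℓ → Set ℓ
Overlap A B = (∃ λ x → A x × B x) × ¬ (A ⊆ B) × ¬ (B ⊆ A)

record IsPatchwork {Ω : Set ℓ} (𝒫 : Pred (Pred Ω ℓ) (suc ℓ)) : Set (suc ℓ) where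
  field
    respects-≐ : ∀ {A B} → A ≐ B → 𝒫 A → 𝒫 B
    has-∅      : 𝒫 (emptySet Ω)
    has-Ω      : 𝒫 (fullSet Ω)
    closed-∩   : ∀ {A B} → 𝒫 A → 𝒫 B → Overlap A B → 𝒫 (A ∩ B)
    closed-∪   : ∀ {A B} → 𝒫 A → 𝒫 B → Overlap A B → 𝒫 (A ∪ B)
    closed-∖   : ∀ {A B} → 𝒫 A → 𝒫 B → Overlap A B → 𝒫 (A ∖ B)

Generated : {Ω : Set ℓ} → List (Pred Ω ℓ) → Pred (Pred Ω ℓ) (suc (suc ℓ))
Generated {ℓ} {Ω} 𝒞 X =
  (𝒫 : Pred (Pred Ω ℓ) (suc ℓ)) → IsPatchwork 𝒫 → (∀ {A} → A ∈ 𝒞 → 𝒫 A) → 𝒫 X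

-- A family of subsets is finite: it has only finitely many members up to
-- extensional equality, i.e. some finite list covers all of them.
FiniteFamily : {Ω : Set ℓ} {ℓ' : Level} → Pred (Pred Ω ℓ) ℓ' → Set _
FiniteFamily {ℓ} {Ω} 𝒫 =
  ∃ λ (L : List (Pred Ω ℓ)) → ∀ X → 𝒫 X → ∃ λ Y → Y ∈ L × X ≐ Y

-- Write 𝒞 = C₀ … Cₙ₋₁. Every member of the generated patchwork is, up to
-- extensional equality, a finite union of terms (⋂ᵢ∈T Cᵢ) ∖ (⋃σ∈S atom σ),
-- where T is a set of indices and S a set of atoms of the Boolean algebra
-- generated by 𝒞. Such unions contain ∅, Ω and each Cᵢ and are closed under
-- ∩, ∪ and ∖ even without the overlap condition: the complement of a union
-- is the term removing exactly the atoms that satisfy it, which holds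
-- constructively because every point lies in some atom up to double
-- negation. As T and S range over finite sets, there are only finitely many
-- such unions.
module Submission where

open import Defs
open import Level using (Level; Lift; lift) renaming (suc to lsuc)
open import Function using (_∘_; _⇔_; mk⇔; Equivalence)
open import Data.Bool using (Bool; true; false; if_then_else_)
import Data.Bool.Properties as Bool
open import Data.Empty using (⊥-elim)
open import Data.Unit.Polymorphic using (⊤)
open import Data.Nat using (ℕ; zero; suc)
open import Data.Fin using (Fin; zero; suc)
import Data.Fin.Properties as Fin
open import Data.Product using (_×_; _,_; proj₁; proj₂; ∃; uncurry)
import Data.Product as Product
import Data.Product.Properties as Product
import Data.Sum as Sum
open import Data.Vec using (Vec; []; _∷_)
import Data.Vec as Vec
import Data.Vec.Properties as Vec
open import Data.List using (List; []; _∷_; [_]; _++_; map; filter; length; lookup; allFin; cartesianProduct; cartesianProductWith)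
import Data.List.Properties as List
open import Data.List.Membership.Propositional using (_∈_; _∉_)
open import Data.List.Membership.Propositional.Properties using (∈-++⁺ˡ; ∈-++⁺ʳ; ∈-map⁺; ∈-map⁻; ∈-filter⁺; ∈-filter⁻; ∈-allFin; ∈-cartesianProductWith⁺; ∈-cartesianProduct⁺)
import Data.List.Membership.DecPropositional as DecMembership
open import Data.List.Relation.Binary.Subset.Propositional using (_⊆_)
open import Data.List.Relation.Binary.Subset.Propositional.Properties using (Any-resp-⊆; All-resp-⊇)
open import Data.List.Relation.Unary.All as All using (All; []; _∷_)
import Data.List.Relation.Unary.All.Properties as All
open import Data.List.Relation.Unary.Any as Any using (Any; here; there; index; any?)
import Data.List.Relation.Unary.Any.Properties as Any
open import Relation.Nullary using (¬_; Dec; does; _×-dec_; ¬?)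
open import Relation.Binary.Definitions using (DecidableEquality)
open import Relation.Binary.PropositionalEquality using (_≡_; refl; cong; subst)
open import Relation.Unary using (Pred; Decidable; _≐_; _∩_; _∪_; ∁)
open import Relation.Unary.Properties using (≐-refl; ≐-sym; ≐-trans)

private variable
  a ℓ ℓ₁ ℓ₂ ℓ₃ ℓ₄ : Level
  A : Set a

sublists : List A → List (List A)
sublists []       = [ [] ]
sublists (x ∷ xs) = map (x ∷_) (sublists xs) ++ sublists xs

filter∈sublists : {P : Pred A ℓ} (P? : Decidable P) (xs : List A) →
                  filter P? xs ∈ sublists xs
filter∈sublists P? []       = here refl
filter∈sublists P? (x ∷ xs) with does (P? x)
... | true  = ∈-++⁺ˡ (∈-map⁺ (x ∷_) (filter∈sublists P? xs))
... | false = ∈-++⁺ʳ (map (x ∷_) (sublists xs)) (filter∈sublists P? xs)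

allVecs : List A → (n : ℕ) → List (Vec A n)
allVecs xs zero    = [ [] ]
allVecs xs (suc n) = cartesianProductWith _∷_ xs (allVecs xs n)

∈-allVecs : {xs : List A} → (∀ x → x ∈ xs) → ∀ {n} (v : Vec A n) → v ∈ allVecs xs n
∈-allVecs complete []      = here refl
∈-allVecs complete (x ∷ v) = ∈-cartesianProductWith⁺ _∷_ (complete x) (∈-allVecs complete v)

-- Lists with the same members inside enum get the same representative.
module _ (_≟_ : DecidableEquality A) (enum : List A) where
  open DecMembership _≟_ using (_∈?_)

  canonical : List A → List A
  canonical xs = filter (_∈? xs) enum

  canonical⊆ : ∀ xs → canonical xs ⊆ xs
  canonical⊆ xs x∈ = proj₂ (∈-filter⁻ (_∈? xs) {xs = enum} x∈)

  ⊆canonical : ∀ {xs} → xs ⊆ enum → xs ⊆ canonical xs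
  ⊆canonical xs⊆enum x∈ = ∈-filter⁺ (_∈? _) (xs⊆enum x∈) x∈

  canonical∈sublists : ∀ xs → canonical xs ∈ sublists enum
  canonical∈sublists xs = filter∈sublists (_∈? xs) enum

module _ {Ω : Set a} {P : Pred Ω ℓ₁} {P′ : Pred Ω ℓ₂} {Q : Pred Ω ℓ₃} {Q′ : Pred Ω ℓ₄} where

  ∩-cong : P ≐ P′ → Q ≐ Q′ → P ∩ Q ≐ P′ ∩ Q′
  ∩-cong (f , f′) (g , g′) = Product.map f g , Product.map f′ g′

  ∪-cong : P ≐ P′ → Q ≐ Q′ → P ∪ Q ≐ P′ ∪ Q′
  ∪-cong (f , f′) (g , g′) = Sum.map f g , Sum.map f′ g′

∁-cong : {Ω : Set a} {P : Pred Ω ℓ₁} {P′ : Pred Ω ℓ₂} → P ≐ P′ → ∁ P ≐ ∁ P′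
∁-cong (f , f′) = (_∘ f′) , (_∘ f)

FiniteFamily-anti-mono : {Ω : Set ℓ} {𝒫 : Pred (Pred Ω ℓ) ℓ₁} {𝒬 : Pred (Pred Ω ℓ) ℓ₂} →
                         (∀ {X} → 𝒫 X → 𝒬 X) → FiniteFamily 𝒬 → FiniteFamily 𝒫
FiniteFamily-anti-mono 𝒫⊆𝒬 (L , cover) = L , λ X X∈𝒫 → cover X (𝒫⊆𝒬 X∈𝒫)

module _ {Ω : Set ℓ} where

  Atom : (Ps : List (Pred Ω ℓ)) → Vec Bool (length Ps) → Pred Ω ℓ
  Atom []       []      x = ⊤
  Atom (P ∷ Ps) (b ∷ σ) x = (if b then P x else ¬ P x) × Atom Ps σ x

  Atom-lookup : ∀ Ps σ i {x} → Atom Ps σ x → (Vec.lookup σ i ≡ true ⇔ lookup Ps i x)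
  Atom-lookup (P ∷ Ps) (true  ∷ σ) zero    (p  , _) = mk⇔ (λ _ → p) (λ _ → refl)
  Atom-lookup (P ∷ Ps) (false ∷ σ) zero    (¬p , _) = mk⇔ (λ ()) (⊥-elim ∘ ¬p)
  Atom-lookup (P ∷ Ps) (b     ∷ σ) (suc i) (_  , α) = Atom-lookup Ps σ i α

  Atom-functional : ∀ Ps σ τ {x} → Atom Ps σ x → Atom Ps τ x → σ ≡ τ
  Atom-functional []       []          []          _        _        = refl
  Atom-functional (P ∷ Ps) (true  ∷ σ) (true  ∷ τ) (_ , α)  (_ , β)  = cong (true ∷_) (Atom-functional Ps σ τ α β)
  Atom-functional (P ∷ Ps) (false ∷ σ) (false ∷ τ) (_ , α)  (_ , β)  = cong (false ∷_) (Atom-functional Ps σ τ α β)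
  Atom-functional (P ∷ Ps) (true  ∷ σ) (false ∷ τ) (p , _)  (¬p , _) = ⊥-elim (¬p p)
  Atom-functional (P ∷ Ps) (false ∷ σ) (true  ∷ τ) (¬p , _) (p , _)  = ⊥-elim (¬p p)

  ¬¬-Atom : ∀ Ps x → ¬ ¬ ∃ λ σ → Atom Ps σ x
  ¬¬-Atom []       x ¬atom = ¬atom ([] , _)
  ¬¬-Atom (P ∷ Ps) x ¬atom = ¬¬-Atom Ps x λ (σ , α) →
    ¬atom (false ∷ σ , (λ p → ¬atom (true ∷ σ , p , α)) , α)

module DisjunctiveNormalForm {Ω : Set ℓ} (Ps : List (Pred Ω ℓ)) where

  n : ℕ
  n = length Ps

  Signature : Set
  Signature = Vec Bool n

  _≟ˢ_ : DecidableEquality Signature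
  _≟ˢ_ = Vec.≡-dec Bool._≟_

  signatures : List Signature
  signatures = allVecs (true ∷ false ∷ []) n

  ∈-signatures : ∀ σ → σ ∈ signatures
  ∈-signatures = ∈-allVecs λ { true → here refl ; false → there (here refl) }

  Term : Set
  Term = List (Fin n) × List Signature

  DNF : Set
  DNF = List Term

  _≟ₜ_ : DecidableEquality Term
  _≟ₜ_ = Product.≡-dec (List.≡-dec Fin._≟_) (List.≡-dec _≟ˢ_)

  ⟦_⟧ₜ : Term → Pred Ω ℓ
  ⟦ T , S ⟧ₜ x = All (λ i → lookup Ps i x) T × All (λ σ → ¬ Atom Ps σ x) S

  ⟦_⟧ : DNF → Pred Ω ℓ
  ⟦ F ⟧ x = Any (λ t → ⟦ t ⟧ₜ x) F

  ⟦⟧-mono : ∀ {F G} → F ⊆ G → ∀ {x} → ⟦ F ⟧ x → ⟦ G ⟧ x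
  ⟦⟧-mono F⊆G = Any-resp-⊆ F⊆G

  literal : Fin n → DNF
  literal i = [ [ i ] , [] ]

  ⟦literal⟧ : ∀ i → ⟦ literal i ⟧ ≐ lookup Ps i
  ⟦literal⟧ i = (λ { (here (p ∷ [] , [])) → p }) , λ p → here (p ∷ [] , [])

  _∧ₜ_ : Term → Term → Term
  (T , S) ∧ₜ (T′ , S′) = T ++ T′ , S ++ S′

  ⟦∧ₜ⟧ : ∀ t u → ⟦ t ∧ₜ u ⟧ₜ ≐ ⟦ t ⟧ₜ ∩ ⟦ u ⟧ₜ
  ⟦∧ₜ⟧ (T , S) (T′ , S′) =
    (λ (p , q) → (All.++⁻ˡ T p , All.++⁻ˡ S q) , (All.++⁻ʳ T p , All.++⁻ʳ S q)) ,
    (λ ((p , q) , (p′ , q′)) → All.++⁺ p p′ , All.++⁺ q q′)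

  _∧_ : DNF → DNF → DNF
  _∧_ = cartesianProductWith _∧ₜ_

  ⟦∧⟧ : ∀ F G → ⟦ F ∧ G ⟧ ≐ ⟦ F ⟧ ∩ ⟦ G ⟧
  ⟦∧⟧ F G = Any.cartesianProductWith⁻ _∧ₜ_ (proj₁ (⟦∧ₜ⟧ _ _)) F G ,
            uncurry (Any.cartesianProductWith⁺ _∧ₜ_ λ p q → proj₂ (⟦∧ₜ⟧ _ _) (p , q))

  ⟦++⟧ : ∀ F G → ⟦ F ++ G ⟧ ≐ ⟦ F ⟧ ∪ ⟦ G ⟧
  ⟦++⟧ F G = Any.++⁻ F , Sum.[ Any.++⁺ˡ , Any.++⁺ʳ F ]

  _⊨_ : Signature → Term → Set
  σ ⊨ (T , S) = All (λ i → Vec.lookup σ i ≡ true) T × σ ∉ S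

  _⊨?_ : ∀ σ t → Dec (σ ⊨ t)
  σ ⊨? (T , S) = All.all? (λ i → Vec.lookup σ i Bool.≟ true) T ×-dec ¬? (σ ∈? S)
    where open DecMembership _≟ˢ_ using (_∈?_)

  Atom⇒⟦⟧ₜ⇔⊨ : ∀ {σ x} t → Atom Ps σ x → (⟦ t ⟧ₜ x ⇔ σ ⊨ t)
  Atom⇒⟦⟧ₜ⇔⊨ {σ} (T , S) α = mk⇔
    (λ (p , q) → All.map (λ {i} → Equivalence.from (Atom-lookup Ps σ i α)) p ,
                 λ σ∈S → All.lookup q σ∈S α)
    (λ (p , σ∉S) → All.map (λ {i} → Equivalence.to (Atom-lookup Ps σ i α)) p ,
                   All.tabulate λ {τ} τ∈S β → σ∉S (subst (_∈ S) (Atom-functional Ps τ σ β α) τ∈S))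

  Atom⇒⟦⟧⇔⊨ : ∀ {σ x} F → Atom Ps σ x → (⟦ F ⟧ x ⇔ Any (σ ⊨_) F)
  Atom⇒⟦⟧⇔⊨ F α = mk⇔ (Any.map λ {t} → Equivalence.to (Atom⇒⟦⟧ₜ⇔⊨ t α))
                      (Any.map λ {t} → Equivalence.from (Atom⇒⟦⟧ₜ⇔⊨ t α))

  ∁-by-atoms : {P : Pred Ω ℓ} {Sat : Pred Signature ℓ₁} (Sat? : Decidable Sat) →
             (∀ {σ x} → Atom Ps σ x → (P x ⇔ Sat σ)) →
             ⟦ [ [] , filter Sat? signatures ] ⟧ ≐ ∁ P
  ∁-by-atoms {P = P} Sat? P⇔Sat = outside , inside
    where
      outside : ∀ {x} → ⟦ [ [] , filter Sat? signatures ] ⟧ x → ¬ P x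
      outside {x} (here ([] , avoids)) p = ¬¬-Atom Ps x λ (σ , α) →
        All.lookup avoids (∈-filter⁺ Sat? (∈-signatures σ) (Equivalence.to (P⇔Sat α) p)) α
      inside : ∀ {x} → ¬ P x → ⟦ [ [] , filter Sat? signatures ] ⟧ x
      inside ¬p = here ([] , All.tabulate λ σ∈ α →
        ¬p (Equivalence.from (P⇔Sat α) (proj₂ (∈-filter⁻ Sat? {xs = signatures} σ∈))))

  ∁ₙ : DNF → DNF
  ∁ₙ F = [ [] , filter (λ σ → any? (σ ⊨?_) F) signatures ]

  ⟦∁ₙ⟧ : ∀ F → ⟦ ∁ₙ F ⟧ ≐ ∁ ⟦ F ⟧
  ⟦∁ₙ⟧ F = ∁-by-atoms (λ σ → any? (σ ⊨?_) F) (Atom⇒⟦⟧⇔⊨ F)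

  Representable : Pred (Pred Ω ℓ) (lsuc ℓ)
  Representable X = Lift (lsuc ℓ) (∃ λ F → X ≐ ⟦ F ⟧)

  module _ {A B : Pred Ω ℓ} where

    representable-∩ : Representable A → Representable B → Representable (A ∩ B)
    representable-∩ (lift (F , A≐F)) (lift (G , B≐G)) =
      lift (F ∧ G , ≐-trans (∩-cong A≐F B≐G) (≐-sym (⟦∧⟧ F G)))

    representable-∪ : Representable A → Representable B → Representable (A ∪ B)
    representable-∪ (lift (F , A≐F)) (lift (G , B≐G)) =
      lift (F ++ G , ≐-trans (∪-cong A≐F B≐G) (≐-sym (⟦++⟧ F G)))

    representable-∖ : Representable A → Representable B → Representable (A ∩ ∁ B)
    representable-∖ (lift (F , A≐F)) (lift (G , B≐G)) =
      lift (F ∧ ∁ₙ G , ≐-trans (∩-cong A≐F (≐-trans (∁-cong B≐G) (≐-sym (⟦∁ₙ⟧ G))))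
                               (≐-sym (⟦∧⟧ F (∁ₙ G))))

  representable-isPatchwork : IsPatchwork Representable
  representable-isPatchwork = record
    { respects-≐ = λ X≐Y (lift (F , X≐F)) → lift (F , ≐-trans (≐-sym X≐Y) X≐F)
    ; has-∅      = lift ([] , (λ { (lift ()) }) , λ ())
    ; has-Ω      = lift ([ [] , [] ] , (λ _ → here ([] , [])) , _)
    ; closed-∩   = λ A B _ → representable-∩ A B
    ; closed-∪   = λ A B _ → representable-∪ A B
    ; closed-∖   = λ A B _ → representable-∖ A B
    }

  ∈⇒representable : ∀ {A} → A ∈ Ps → Representable A
  ∈⇒representable {A} A∈Ps = lift (literal (index A∈Ps) ,
    ≐-trans (subst (A ≐_) (Any.lookup-index A∈Ps) ≐-refl) (≐-sym (⟦literal⟧ (index A∈Ps))))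

  terms : List Term
  terms = cartesianProduct (sublists (allFin n)) (sublists signatures)

  canonicalₜ : Term → Term
  canonicalₜ (T , S) = canonical Fin._≟_ (allFin n) T , canonical _≟ˢ_ signatures S

  canonicalₜ∈terms : ∀ t → canonicalₜ t ∈ terms
  canonicalₜ∈terms (T , S) = ∈-cartesianProduct⁺ (canonical∈sublists Fin._≟_ (allFin n) T)
                                                 (canonical∈sublists _≟ˢ_ signatures S)

  ⟦canonicalₜ⟧ : ∀ t → ⟦ canonicalₜ t ⟧ₜ ≐ ⟦ t ⟧ₜ
  ⟦canonicalₜ⟧ (T , S) =
    Product.map (All-resp-⊇ (⊆canonical Fin._≟_ (allFin n) (λ {i} _ → ∈-allFin i)))
                (All-resp-⊇ (⊆canonical _≟ˢ_ signatures (λ {σ} _ → ∈-signatures σ))) ,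
    Product.map (All-resp-⊇ (canonical⊆ Fin._≟_ (allFin n) T))
                (All-resp-⊇ (canonical⊆ _≟ˢ_ signatures S))

  canonicalₙ : DNF → DNF
  canonicalₙ F = canonical _≟ₜ_ terms (map canonicalₜ F)

  ⟦canonicalₙ⟧ : ∀ F → ⟦ canonicalₙ F ⟧ ≐ ⟦ F ⟧
  ⟦canonicalₙ⟧ F = ≐-trans (⟦⟧-mono (canonical⊆ _≟ₜ_ terms (map canonicalₜ F)) ,
                            ⟦⟧-mono (⊆canonical _≟ₜ_ terms map-canonicalₜ⊆terms))
                           ((Any.map (proj₁ (⟦canonicalₜ⟧ _)) ∘ Any.map⁻) ,
                            (Any.map⁺ ∘ Any.map (proj₂ (⟦canonicalₜ⟧ _))))
    where
      map-canonicalₜ⊆terms : map canonicalₜ F ⊆ terms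
      map-canonicalₜ⊆terms t∈ with _ , _ , refl ← ∈-map⁻ canonicalₜ t∈ = canonicalₜ∈terms _

  representable-finite : FiniteFamily Representable
  representable-finite = map ⟦_⟧ (sublists terms) , λ X (lift (F , X≐F)) →
    ⟦ canonicalₙ F ⟧ , ∈-map⁺ ⟦_⟧ (canonical∈sublists _≟ₜ_ terms (map canonicalₜ F)) ,
    ≐-trans X≐F (≐-sym (⟦canonicalₙ⟧ F))

lemma3p3 : {ℓ : Level} (Ω : Set ℓ) (𝒞 : List (Pred Ω ℓ)) →
    FiniteFamily (Generated {Ω = Ω} 𝒞)
lemma3p3 Ω 𝒞 = FiniteFamily-anti-mono
  (λ X∈⟨𝒞⟩ → X∈⟨𝒞⟩ Representable representable-isPatchwork ∈⇒representable)
  representable-finite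
  where open DisjunctiveNormalForm 𝒞
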